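{- Let $H=(V,E)$ and $H'=(V',E')$ be $d$-uniform hypergraphs with $d\ge 3$. Then $\mathrm{Z}_0(H\,\Box\, H')\le \mathrm{Z}_0(H)\,\mathrm{Z}_0(H')$.
   Context: For a set $S$ and an object $v$, $S\times v=\{(x,v):x\in S\}$ and $v\times S=\{(v,x):x\in S\}$. The Cartesian product $H\Box H'$ is the $d$-hypergraph with vertex set $V\times V'$ and edge set $\{e\times v': e\in E, v'\in V'\}\cup\{v\times e': v\in V, e'\in E'\}$. $\mathrm{Z}_0$ of a $d$-hypergraph: with a set $B$ initially blue and the others white, a set $S$ of $d-1$ distinct vertices (not necessarily blue) can turn a white vertex $w$ blue if $S\cup\{w\}$ is an edge and every white $u$ such that $S\cup\{u\}$ is an edge equals $w$. $B$ is a zero forcing set if repeated application colors all vertices blue; $\mathrm{Z}_0$ is the minimum cardinality of a zero forcing set. -}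

module Defs where

open import Data.Nat using (ℕ; _∸_; _*_)
open import Data.Bool using (Bool; true; false; _∧_)
open import Data.Fin using (Fin; remQuot; quotient; remainder)
open import Data.Fin.Properties using (_≟_)
open import Data.Fin.Subset using (Subset; _∈_; _∉_; _∪_; ⁅_⁆; ∣_∣; ⊤)
open import Data.Vec using (tabulate; lookup)
open import Data.List using (List; concatMap; map; _++_; allFin)
open import Data.List.Relation.Unary.All using (All)
import Data.List.Membership.Propositional as LMem
open import Data.Product using (Σ; _×_; proj₁; proj₂)
open import Relation.Nullary.Decidable using (⌊_⌋)
open import Relation.Binary.PropositionalEquality using (_≡_)
open import Relation.Binary.Construct.Closure.ReflexiveTransitive using (Star)

record Hypergraph : Set where
  constructor hypergraph
  field
    n     : ℕ
    edges : List (Subset n)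
open Hypergraph public

Uniform : ℕ → Hypergraph → Set
Uniform d H = All (λ e → ∣ e ∣ ≡ d) (edges H)

IsEdge : (H : Hypergraph) → Subset (n H) → Set
IsEdge H e = LMem._∈_ e (edges H)

Forces : (d : ℕ) (H : Hypergraph) → Subset (n H) → Subset (n H) → Fin (n H) → Set
Forces d H B S w =
  ∣ S ∣ ≡ d ∸ 1 × w ∉ B × w ∉ S × IsEdge H (S ∪ ⁅ w ⁆) ×
  ((u : Fin (n H)) → u ∉ B → IsEdge H (S ∪ ⁅ u ⁆) → u ≡ w)

Step : (d : ℕ) (H : Hypergraph) → Subset (n H) → Subset (n H) → Set
Step d H B B' = Σ (Subset (n H)) λ S → Σ (Fin (n H)) λ w → Forces d H B S w × B' ≡ B ∪ ⁅ w ⁆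

IsZeroForcingSet : (d : ℕ) (H : Hypergraph) → Subset (n H) → Set
IsZeroForcingSet d H B = Star (Step d H) B ⊤

IsZ0 : (d : ℕ) (H : Hypergraph) → ℕ → Set
IsZ0 d H k =
  (Σ (Subset (n H)) λ B → IsZeroForcingSet d H B × ∣ B ∣ ≡ k) ×
  ((B : Subset (n H)) → IsZeroForcingSet d H B → k Data.Nat.≤ ∣ B ∣)

-- Cartesian product. Vertex (x , y) is encoded as combine x y : Fin (n * n'),
-- with inverse remQuot.
_×E_ : {m k : ℕ} → Subset m → Fin k → Subset (m * k)
_×E_ {m} {k} e y = tabulate λ z → lookup e (quotient k z) ∧ ⌊ remainder {m} k z ≟ y ⌋

_E×_ : {m k : ℕ} → Fin m → Subset k → Subset (m * k)
_E×_ {m} {k} x e = tabulate λ z → ⌊ quotient {m} k z ≟ x ⌋ ∧ lookup e (remainder {m} k z)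

_□_ : Hypergraph → Hypergraph → Hypergraph
H □ H' = hypergraph (n H * n H')
  (concatMap (λ e → map (λ y → e ×E y) (allFin (n H'))) (edges H)
   ++ concatMap (λ x → map (λ e' → x E× e') (edges H')) (allFin (n H)))

module Submission where

-- If B and B′ are zero forcing sets of H and H′, then B × B′ is one of H □ H′.
-- For every y ∈ B′ the layer H × {y} starts with B × {y} blue, and the forcing
-- chain of B can be replayed there: a force S → w of H becomes the force
-- S × {y} → (w , y), unless (w , y) is already blue. This is where d ≥ 3 enters:
-- S has two distinct vertices, so an edge of H □ H′ through S × {y} cannot be of
-- the form {x} × e′, hence is e × {y} for an edge e = S ∪ {u} of H; the white
-- vertices completing S × {y} to an edge are therefore exactly the images of
-- those completing S. Once V × B′ is blue, the same argument in every layer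
-- {x} × H′ replays the chain of B′.

open import Defs
open import Data.Nat using (ℕ; _≤_; _*_; zero; suc; _+_; s≤s)
import Data.Nat.Properties as ℕ
open import Algebra.Properties.Semiring.Sum ℕ.+-*-semiring
  using (sum-syntax; sum-cong-≗; *-distribˡ-sum; *-distribʳ-sum)
open import Data.Bool using (Bool; true; false; _∧_; _∨_)
open import Data.Bool.Properties using (∧-distribʳ-∨; ∧-distribˡ-∨; ¬-not)
open import Data.Fin as Fin using (Fin; combine; quotient; remainder; _↑ˡ_; _↑ʳ_)
open import Data.Fin.Properties using (_≟_; remQuot-combine; combine-remQuot; suc-injective)
open import Data.Fin.Subset using (Subset; _∈_; _∉_; _∪_; ⁅_⁆; ∣_∣; ⊤; _⊆_; Nonempty)
open import Data.Fin.Subset.Properties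
  using (_∈?_; ∈⊤; ⊆-antisym; ⊆⊤; ∣⁅x⁆∣≡1; x∈⁅x⁆; x∈⁅y⁆⇒x≡y; x≢y⇒x∉⁅y⁆; p⊆p∪q; x∈p∪q⁻; x∈p∪q⁺)
open import Data.Vec as Vec using ([]; _∷_; tabulate; lookup)
open import Data.Vec.Properties
  using (lookup∘tabulate; tabulate∘lookup; tabulate-cong; lookup-zipWith; []=⇒lookup; lookup⇒[]=)
open import Data.Product using (∃; ∃₂; _×_; _,_; proj₁; proj₂; uncurry)
open import Data.Sum using (_⊎_; inj₁; inj₂)
open import Data.Empty using (⊥-elim)
open import Data.List using (List; []; _∷_; filter; allFin; map; concatMap)
open import Data.List.Relation.Unary.Any using (here; there)
open import Data.List.Membership.Propositional using (lose; find) renaming (_∈_ to _∈ₗ_)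
open import Data.List.Membership.Propositional.Properties
  using (∈-filter⁺; ∈-filter⁻; ∈-allFin; ∈-map⁺; ∈-map⁻; ∈-++⁺ˡ; ∈-++⁺ʳ; ∈-++⁻; ∈-concatMap⁺; ∈-concatMap⁻)
open import Relation.Binary.Construct.Closure.ReflexiveTransitive using (Star; ε; _◅_; _◅◅_)
open import Function using (_∘_)
open import Relation.Nullary.Decidable using (⌊_⌋; yes; no)
open import Relation.Binary.PropositionalEquality
open ≡-Reasoning

private
  variable
    m k : ℕ

𝟙 : Bool → ℕ
𝟙 true  = 1
𝟙 false = 0

𝟙-∧ : ∀ x y → 𝟙 (x ∧ y) ≡ 𝟙 x * 𝟙 y
𝟙-∧ true  y = sym (ℕ.+-identityʳ (𝟙 y))
𝟙-∧ false y = refl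

∣p∣≡∑𝟙 : ∀ (p : Subset m) → ∣ p ∣ ≡ ∑[ a < m ] 𝟙 (lookup p a)
∣p∣≡∑𝟙 []          = refl
∣p∣≡∑𝟙 (true ∷ p)  = cong suc (∣p∣≡∑𝟙 p)
∣p∣≡∑𝟙 (false ∷ p) = ∣p∣≡∑𝟙 p

∑-↑ : ∀ m k (f : Fin (m + k) → ℕ) →
  ∑[ z < m + k ] f z ≡ ∑[ a < m ] f (a ↑ˡ k) + ∑[ b < k ] f (m ↑ʳ b)
∑-↑ zero    k f = refl
∑-↑ (suc m) k f = trans (cong (f Fin.zero +_) (∑-↑ m k (λ z → f (Fin.suc z))))
  (sym (ℕ.+-assoc (f Fin.zero) _ _))

∑-combine : ∀ m k (f : Fin (m * k) → ℕ) →
  ∑[ z < m * k ] f z ≡ ∑[ a < m ] ∑[ b < k ] f (combine a b)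
∑-combine zero    k f = refl
∑-combine (suc m) k f = trans (∑-↑ k (m * k) f)
  (cong (∑[ b < k ] f (b ↑ˡ (m * k)) +_) (∑-combine m k (λ z → f (k ↑ʳ z))))

∑∑-* : ∀ m k (f : Fin m → ℕ) (g : Fin k → ℕ) →
  ∑[ a < m ] ∑[ b < k ] (f a * g b) ≡ ∑[ a < m ] f a * ∑[ b < k ] g b
∑∑-* m k f g = begin
  ∑[ a < m ] ∑[ b < k ] (f a * g b) ≡⟨ sum-cong-≗ (λ a → *-distribˡ-sum (f a) g) ⟨
  ∑[ a < m ] (f a * ∑[ b < k ] g b) ≡⟨ *-distribʳ-sum (∑[ b < k ] g b) f ⟨
  ∑[ a < m ] f a * ∑[ b < k ] g b   ∎

∧≡true⁻ : ∀ {x y} → x ∧ y ≡ true → x ≡ true × y ≡ true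
∧≡true⁻ {true} y≡true = refl , y≡true

lookup-⁅⁆ : ∀ (y x : Fin m) → lookup ⁅ y ⁆ x ≡ ⌊ x ≟ y ⌋
lookup-⁅⁆ y x with x ≟ y
... | yes refl = []=⇒lookup (x∈⁅x⁆ y)
... | no x≢y   = ¬-not (x≢y⇒x∉⁅y⁆ x≢y ∘ lookup⇒[]= x ⁅ y ⁆)

tabulate-∪ : ∀ (f g : Fin m → Bool) → tabulate f ∪ tabulate g ≡ tabulate (λ z → f z ∨ g z)
tabulate-∪ f g = trans (sym (tabulate∘lookup _)) (tabulate-cong λ z →
  trans (lookup-zipWith _∨_ z (tabulate f) (tabulate g))
        (cong₂ _∨_ (lookup∘tabulate f z) (lookup∘tabulate g z)))

∣p∣≥1⇒nonempty : ∀ (p : Subset m) → 1 ≤ ∣ p ∣ → Nonempty p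
∣p∣≥1⇒nonempty (true ∷ p)  _ = Fin.zero , Vec.here
∣p∣≥1⇒nonempty (false ∷ p) h with x , x∈p ← ∣p∣≥1⇒nonempty p h = Fin.suc x , Vec.there x∈p

∣p∣≥2⇒distinct : ∀ (p : Subset m) → 2 ≤ ∣ p ∣ → ∃₂ λ x y → x ∈ p × y ∈ p × x ≢ y
∣p∣≥2⇒distinct (true ∷ p) (s≤s h) with y , y∈p ← ∣p∣≥1⇒nonempty p h =
  Fin.zero , Fin.suc y , Vec.here , Vec.there y∈p , λ ()
∣p∣≥2⇒distinct (false ∷ p) h with x , y , x∈p , y∈p , x≢y ← ∣p∣≥2⇒distinct p h =
  Fin.suc x , Fin.suc y , Vec.there x∈p , Vec.there y∈p , x≢y ∘ suc-injective

data Combined (m k : ℕ) : Fin (m * k) → Set where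
  combined : ∀ (a : Fin m) (b : Fin k) → Combined m k (combine a b)

combined-view : ∀ (z : Fin (m * k)) → Combined m k z
combined-view {m} {k} z = subst (Combined m k) (combine-remQuot {m} k z) (combined _ _)

∀combine∈⇒≡⊤ : ∀ {C : Subset (m * k)} → (∀ (a : Fin m) (b : Fin k) → combine a b ∈ C) → C ≡ ⊤
∀combine∈⇒≡⊤ {m} {k} all∈ = ⊆-antisym ⊆⊤ λ {z} _ → subst (_∈ _) (combine-remQuot {m} k z) (all∈ _ _)

infixr 7 _⊠_

-- The product B × B′ as a subset of Fin (m * k). It is opaque so that it is only
-- used through lookup-⊠, which also lets Agda infer p and q from p ⊠ q.
opaque
  _⊠_ : Subset m → Subset k → Subset (m * k)
  _⊠_ {m} {k} p q = tabulate λ z → lookup p (quotient k z) ∧ lookup q (remainder {m} k z)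

  lookup-⊠ : ∀ (p : Subset m) (q : Subset k) a b → lookup (p ⊠ q) (combine a b) ≡ lookup p a ∧ lookup q b
  lookup-⊠ p q a b = trans (lookup∘tabulate _ (combine a b))
    (cong (uncurry λ a′ b′ → lookup p a′ ∧ lookup q b′) (remQuot-combine a b))

  ∪-distribʳ-⊠ : ∀ (p p′ : Subset m) (q : Subset k) → (p ∪ p′) ⊠ q ≡ p ⊠ q ∪ p′ ⊠ q
  ∪-distribʳ-⊠ {m} {k} p p′ q = trans
    (tabulate-cong λ z → trans (cong (_∧ _) (lookup-zipWith _∨_ (quotient k z) p p′))
      (∧-distribʳ-∨ (lookup q (remainder {m} k z)) (lookup p (quotient k z)) (lookup p′ (quotient k z))))
    (sym (tabulate-∪ _ _))

  ⊠-distribˡ-∪ : ∀ (p : Subset m) (q q′ : Subset k) → p ⊠ (q ∪ q′) ≡ p ⊠ q ∪ p ⊠ q′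
  ⊠-distribˡ-∪ {m} {k} p q q′ = trans
    (tabulate-cong λ z → trans (cong (_ ∧_) (lookup-zipWith _∨_ (remainder {m} k z) q q′))
      (∧-distribˡ-∨ (lookup p (quotient k z)) (lookup q (remainder {m} k z)) (lookup q′ (remainder {m} k z))))
    (sym (tabulate-∪ _ _))

  ×E≡⊠⁅⁆ : ∀ (e : Subset m) (y : Fin k) → e ×E y ≡ e ⊠ ⁅ y ⁆
  ×E≡⊠⁅⁆ {m} {k} e y = tabulate-cong λ z →
    cong (lookup e (quotient k z) ∧_) (sym (lookup-⁅⁆ y (remainder {m} k z)))

  E×≡⁅⁆⊠ : ∀ (x : Fin m) (e : Subset k) → x E× e ≡ ⁅ x ⁆ ⊠ e
  E×≡⁅⁆⊠ {m} {k} x e = tabulate-cong λ z →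
    cong (_∧ lookup e (remainder {m} k z)) (sym (lookup-⁅⁆ x (quotient k z)))

∈⊠⁺ : ∀ {p : Subset m} {q : Subset k} {a b} → a ∈ p → b ∈ q → combine a b ∈ p ⊠ q
∈⊠⁺ {p = p} {q} {a} {b} a∈p b∈q = lookup⇒[]= (combine a b) (p ⊠ q)
  (trans (lookup-⊠ p q a b) (cong₂ _∧_ ([]=⇒lookup a∈p) ([]=⇒lookup b∈q)))

∈⊠⁻ : ∀ {p : Subset m} {q : Subset k} a b → combine a b ∈ p ⊠ q → a ∈ p × b ∈ q
∈⊠⁻ {p = p} {q} a b ab∈p⊠q with ∧≡true⁻ (trans (sym (lookup-⊠ p q a b)) ([]=⇒lookup ab∈p⊠q))
... | pa , qb = lookup⇒[]= a p pa , lookup⇒[]= b q qb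

∣⊠∣ : ∀ (p : Subset m) (q : Subset k) → ∣ p ⊠ q ∣ ≡ ∣ p ∣ * ∣ q ∣
∣⊠∣ {m} {k} p q = begin
  ∣ p ⊠ q ∣                                                      ≡⟨ ∣p∣≡∑𝟙 (p ⊠ q) ⟩
  ∑[ z < m * k ] 𝟙 (lookup (p ⊠ q) z)                             ≡⟨ ∑-combine m k _ ⟩
  ∑[ a < m ] ∑[ b < k ] 𝟙 (lookup (p ⊠ q) (combine a b))          ≡⟨ sum-cong-≗ (λ a → sum-cong-≗ λ b →
                                                                      trans (cong 𝟙 (lookup-⊠ p q a b)) (𝟙-∧ (lookup p a) (lookup q b))) ⟩
  ∑[ a < m ] ∑[ b < k ] (𝟙 (lookup p a) * 𝟙 (lookup q b))         ≡⟨ ∑∑-* m k _ _ ⟩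
  ∑[ a < m ] 𝟙 (lookup p a) * ∑[ b < k ] 𝟙 (lookup q b)           ≡⟨ cong₂ _*_ (∣p∣≡∑𝟙 p) (∣p∣≡∑𝟙 q) ⟨
  ∣ p ∣ * ∣ q ∣                                                  ∎

⁅⁆⊠⁅⁆ : ∀ (a : Fin m) (b : Fin k) → ⁅ a ⁆ ⊠ ⁅ b ⁆ ≡ ⁅ combine a b ⁆
⁅⁆⊠⁅⁆ {m} {k} a b = ⊆-antisym ⊆⁅ab⁆ ⁅ab⁆⊆
  where
  ⊆⁅ab⁆ : ⁅ a ⁆ ⊠ ⁅ b ⁆ ⊆ ⁅ combine a b ⁆
  ⊆⁅ab⁆ {z} z∈ with combined-view {m} {k} z
  ... | combined a′ b′ with a′∈ , b′∈ ← ∈⊠⁻ a′ b′ z∈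
    = subst (_∈ ⁅ combine a b ⁆) (cong₂ combine (sym (x∈⁅y⁆⇒x≡y a a′∈)) (sym (x∈⁅y⁆⇒x≡y b b′∈)))
        (x∈⁅x⁆ (combine a b))
  ⁅ab⁆⊆ : ⁅ combine a b ⁆ ⊆ ⁅ a ⁆ ⊠ ⁅ b ⁆
  ⁅ab⁆⊆ z∈ rewrite x∈⁅y⁆⇒x≡y _ z∈ = ∈⊠⁺ (x∈⁅x⁆ a) (x∈⁅x⁆ b)

module _ {d : ℕ} {G : Hypergraph} where

  steps-⊆ : ∀ {C C′} → Star (Step d G) C C′ → C ⊆ C′
  steps-⊆ ε                            = λ x∈C → x∈C
  steps-⊆ ((_ , w , _ , refl) ◅ steps) = steps-⊆ steps ∘ p⊆p∪q ⁅ w ⁆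

-- H as a layer of G. The field edge-rigid (edges of G meeting the layer in two
-- distinct vertices come from edges of H) is what lets forces of H be replayed in G.
record FibreEmbedding (H G : Hypergraph) : Set where
  field
    φ          : Fin (n H) → Fin (n G)
    img        : Subset (n H) → Subset (n G)
    ∣img∣      : ∀ S → ∣ img S ∣ ≡ ∣ S ∣
    ∈img⁺      : ∀ {S x} → x ∈ S → φ x ∈ img S
    φ∈img⁻     : ∀ {S x} → φ x ∈ img S → x ∈ S
    img⊆range  : ∀ {S z} → z ∈ img S → ∃ λ x → z ≡ φ x
    img-∪⁅⁆    : ∀ S x → img (S ∪ ⁅ x ⁆) ≡ img S ∪ ⁅ φ x ⁆
    img-edge   : ∀ {e} → IsEdge H e → IsEdge G (img e)
    edge-rigid : ∀ {E s₁ s₂} → IsEdge G E → φ s₁ ∈ E → φ s₂ ∈ E → s₁ ≢ s₂ →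
                 ∃ λ e → IsEdge H e × E ≡ img e

module FibreLifting {H G : Hypergraph} (F : FibreEmbedding H G) where
  open FibreEmbedding F

  img-injective : ∀ {S T} → img S ≡ img T → S ≡ T
  img-injective eq = ⊆-antisym (φ∈img⁻ ∘ subst (φ _ ∈_) eq ∘ ∈img⁺)
                               (φ∈img⁻ ∘ subst (φ _ ∈_) (sym eq) ∘ ∈img⁺)

  edge-through-img : ∀ {S s₁ s₂ z} → s₁ ∈ S → s₂ ∈ S → s₁ ≢ s₂ → IsEdge G (img S ∪ ⁅ z ⁆) →
    ∃ λ u → z ≡ φ u × IsEdge H (S ∪ ⁅ u ⁆)
  edge-through-img {S} {z = z} s₁∈S s₂∈S s₁≢s₂ E-edge
    with e , e-edge , E≡img-e ← edge-rigid E-edge (p⊆p∪q ⁅ z ⁆ (∈img⁺ s₁∈S)) (p⊆p∪q ⁅ z ⁆ (∈img⁺ s₂∈S)) s₁≢s₂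
    with u , refl ← img⊆range (subst (z ∈_) E≡img-e (x∈p∪q⁺ (inj₂ (x∈⁅x⁆ z))))
    = u , refl , subst (IsEdge H) (sym (img-injective (trans (img-∪⁅⁆ S u) E≡img-e))) e-edge

  module _ {d : ℕ} (3≤d : 3 ≤ d) where

    forces-lift : ∀ {B S w C} → Forces d H B S w → (∀ {x} → x ∈ B → φ x ∈ C) →
      φ w ∈ C ⊎ Forces d G C (img S) (φ w)
    forces-lift {B} {S} {w} {C} (∣S∣ , w∉B , w∉S , S+w-edge , unique) B↦C with φ w ∈? C
    ... | yes φw∈C = inj₁ φw∈C
    ... | no φw∉C  = inj₂ (trans (∣img∣ S) ∣S∣ , φw∉C , w∉S ∘ φ∈img⁻ ,
                           subst (IsEdge G) (img-∪⁅⁆ S w) (img-edge S+w-edge) , unique′)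
      where
      unique′ : ∀ z → z ∉ C → IsEdge G (img S ∪ ⁅ z ⁆) → z ≡ φ w
      unique′ z z∉C S+z-edge
        with s₁ , s₂ , s₁∈S , s₂∈S , s₁≢s₂ ← ∣p∣≥2⇒distinct S (subst (2 ≤_) (sym ∣S∣) (ℕ.∸-monoˡ-≤ 1 3≤d))
        with u , refl , S+u-edge ← edge-through-img s₁∈S s₂∈S s₁≢s₂ S+z-edge
        = cong φ (unique u (z∉C ∘ B↦C) S+u-edge)

    extend-∪⁅⁆ : ∀ {B w C} → (∀ {x} → x ∈ B → φ x ∈ C) → φ w ∈ C → ∀ {x} → x ∈ B ∪ ⁅ w ⁆ → φ x ∈ C
    extend-∪⁅⁆ {B} {w} B↦C φw∈C x∈B+w with x∈p∪q⁻ B ⁅ w ⁆ x∈B+w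
    ... | inj₁ x∈B = B↦C x∈B
    ... | inj₂ x∈w rewrite x∈⁅y⁆⇒x≡y w x∈w = φw∈C

    steps-lift : ∀ {B B′ C} → Star (Step d H) B B′ → (∀ {x} → x ∈ B → φ x ∈ C) →
      ∃ λ C′ → Star (Step d G) C C′ × (∀ {x} → x ∈ B′ → φ x ∈ C′)
    steps-lift {C = C} ε B↦C = C , ε , B↦C
    steps-lift {C = C} ((S , w , S⇒w , refl) ◅ steps) B↦C with forces-lift S⇒w B↦C
    ... | inj₁ φw∈C = steps-lift steps (extend-∪⁅⁆ B↦C φw∈C)
    ... | inj₂ S⇒φw
      with C′ , steps′ , B′↦C′ ← steps-lift steps (extend-∪⁅⁆ (p⊆p∪q _ ∘ B↦C) (x∈p∪q⁺ (inj₂ (x∈⁅x⁆ (φ w)))))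
      = C′ , (img S , φ w , S⇒φw , refl) ◅ steps′ , B′↦C′

module _ {d : ℕ} (3≤d : 3 ≤ d) {H G : Hypergraph} {X : Set} (F : X → FibreEmbedding H G) where
  open FibreEmbedding

  fibres-lift : ∀ {B C} (L : List X) → IsZeroForcingSet d H B →
    (∀ {i} → i ∈ₗ L → ∀ {x} → x ∈ B → φ (F i) x ∈ C) →
    ∃ λ C′ → Star (Step d G) C C′ × (∀ {i} → i ∈ₗ L → ∀ x → φ (F i) x ∈ C′)
  fibres-lift {C = C} [] _ _ = C , ε , λ ()
  fibres-lift (i ∷ L) zf B↦C
    with C₁ , steps₁ , B↦C₁ ← FibreLifting.steps-lift (F i) 3≤d zf (B↦C (here refl))
    with C₂ , steps₂ , all₂ ← fibres-lift L zf (λ i∈L → steps-⊆ {d = d} steps₁ ∘ B↦C (there i∈L))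
    = C₂ , steps₁ ◅◅ steps₂ , λ where
        (here refl) x → steps-⊆ {d = d} steps₂ (B↦C₁ (∈⊤ {x = x}))
        (there i∈L)   → all₂ i∈L

module _ {H H′ : Hypergraph} where

  private
    rows : Subset (n H) → List (Subset (n H * n H′))
    rows e = map (e ×E_) (allFin (n H′))

    columns : Fin (n H) → List (Subset (n H * n H′))
    columns x = map (x E×_) (edges H′)

  □-edgeˡ : ∀ {e} y → IsEdge H e → IsEdge (H □ H′) (e ⊠ ⁅ y ⁆)
  □-edgeˡ {e} y e-edge = subst (IsEdge (H □ H′)) (×E≡⊠⁅⁆ e y)
    (∈-++⁺ˡ (∈-concatMap⁺ rows (lose e-edge (∈-map⁺ (e ×E_) (∈-allFin y)))))

  □-edgeʳ : ∀ {e′} x → IsEdge H′ e′ → IsEdge (H □ H′) (⁅ x ⁆ ⊠ e′)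
  □-edgeʳ {e′} x e′-edge = subst (IsEdge (H □ H′)) (E×≡⁅⁆⊠ x e′)
    (∈-++⁺ʳ (concatMap rows (edges H)) (∈-concatMap⁺ columns (lose (∈-allFin x) (∈-map⁺ (x E×_) e′-edge))))

  □-edge⁻ : ∀ {E} → IsEdge (H □ H′) E →
    (∃₂ λ e y → IsEdge H e × E ≡ e ⊠ ⁅ y ⁆) ⊎ (∃₂ λ x e′ → IsEdge H′ e′ × E ≡ ⁅ x ⁆ ⊠ e′)
  □-edge⁻ E-edge with ∈-++⁻ (concatMap rows (edges H)) E-edge
  ... | inj₁ E∈rows
    with e , e-edge , E∈row ← find (∈-concatMap⁻ rows {xs = edges H} E∈rows)
    with y , _ , refl ← ∈-map⁻ (e ×E_) E∈row
    = inj₁ (e , y , e-edge , ×E≡⊠⁅⁆ e y)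
  ... | inj₂ E∈columns
    with x , _ , E∈column ← find (∈-concatMap⁻ columns {xs = allFin (n H)} E∈columns)
    with e′ , e′-edge , refl ← ∈-map⁻ (x E×_) E∈column
    = inj₂ (x , e′ , e′-edge , E×≡⁅⁆⊠ x e′)

  fibreˡ : Fin (n H′) → FibreEmbedding H (H □ H′)
  fibreˡ y = record
    { φ          = λ x → combine x y
    ; img        = _⊠ ⁅ y ⁆
    ; ∣img∣      = λ S → trans (∣⊠∣ S ⁅ y ⁆) (trans (cong (∣ S ∣ *_) (∣⁅x⁆∣≡1 y)) (ℕ.*-identityʳ _))
    ; ∈img⁺      = λ x∈S → ∈⊠⁺ x∈S (x∈⁅x⁆ y)
    ; φ∈img⁻     = λ {_} {x} → proj₁ ∘ ∈⊠⁻ x y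
    ; img⊆range  = range
    ; img-∪⁅⁆    = λ S x → trans (∪-distribʳ-⊠ S ⁅ x ⁆ ⁅ y ⁆) (cong (S ⊠ ⁅ y ⁆ ∪_) (⁅⁆⊠⁅⁆ x y))
    ; img-edge   = □-edgeˡ y
    ; edge-rigid = rigid
    }
    where
    range : ∀ {S : Subset (n H)} {z} → z ∈ S ⊠ ⁅ y ⁆ → ∃ λ x → z ≡ combine x y
    range {z = z} z∈ with combined-view {n H} {n H′} z
    ... | combined x y′ with refl ← x∈⁅y⁆⇒x≡y y (proj₂ (∈⊠⁻ x y′ z∈)) = x , refl

    rigid : ∀ {E s₁ s₂} → IsEdge (H □ H′) E → combine s₁ y ∈ E → combine s₂ y ∈ E → s₁ ≢ s₂ →
      ∃ λ e → IsEdge H e × E ≡ e ⊠ ⁅ y ⁆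
    rigid {s₁ = s₁} {s₂} E-edge s₁∈E s₂∈E s₁≢s₂ with □-edge⁻ E-edge
    ... | inj₁ (e , y′ , e-edge , refl) with refl ← x∈⁅y⁆⇒x≡y y′ (proj₂ (∈⊠⁻ s₁ y s₁∈E)) = e , e-edge , refl
    ... | inj₂ (x , _ , _ , refl) = ⊥-elim (s₁≢s₂ (trans (x∈⁅y⁆⇒x≡y x (proj₁ (∈⊠⁻ s₁ y s₁∈E)))
                                                        (sym (x∈⁅y⁆⇒x≡y x (proj₁ (∈⊠⁻ s₂ y s₂∈E))))))

  fibreʳ : Fin (n H) → FibreEmbedding H′ (H □ H′)
  fibreʳ x = record
    { φ          = combine x
    ; img        = ⁅ x ⁆ ⊠_
    ; ∣img∣      = λ S → trans (∣⊠∣ ⁅ x ⁆ S) (trans (cong (_* ∣ S ∣) (∣⁅x⁆∣≡1 x)) (ℕ.*-identityˡ _))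
    ; ∈img⁺      = ∈⊠⁺ (x∈⁅x⁆ x)
    ; φ∈img⁻     = λ {_} {y} → proj₂ ∘ ∈⊠⁻ x y
    ; img⊆range  = range
    ; img-∪⁅⁆    = λ S y → trans (⊠-distribˡ-∪ ⁅ x ⁆ S ⁅ y ⁆) (cong (⁅ x ⁆ ⊠ S ∪_) (⁅⁆⊠⁅⁆ x y))
    ; img-edge   = □-edgeʳ x
    ; edge-rigid = rigid
    }
    where
    range : ∀ {S : Subset (n H′)} {z} → z ∈ ⁅ x ⁆ ⊠ S → ∃ λ y → z ≡ combine x y
    range {z = z} z∈ with combined-view {n H} {n H′} z
    ... | combined x′ y with refl ← x∈⁅y⁆⇒x≡y x (proj₁ (∈⊠⁻ x′ y z∈)) = y , refl

    rigid : ∀ {E s₁ s₂} → IsEdge (H □ H′) E → combine x s₁ ∈ E → combine x s₂ ∈ E → s₁ ≢ s₂ →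
      ∃ λ e′ → IsEdge H′ e′ × E ≡ ⁅ x ⁆ ⊠ e′
    rigid {s₁ = s₁} {s₂} E-edge s₁∈E s₂∈E s₁≢s₂ with □-edge⁻ E-edge
    ... | inj₂ (x′ , e′ , e′-edge , refl) with refl ← x∈⁅y⁆⇒x≡y x′ (proj₁ (∈⊠⁻ x s₁ s₁∈E)) = e′ , e′-edge , refl
    ... | inj₁ (_ , y , _ , refl) = ⊥-elim (s₁≢s₂ (trans (x∈⁅y⁆⇒x≡y y (proj₂ (∈⊠⁻ x s₁ s₁∈E)))
                                                        (sym (x∈⁅y⁆⇒x≡y y (proj₂ (∈⊠⁻ x s₂ s₂∈E))))))

⊠-isZeroForcingSet : ∀ {d H H′ B B′} → 3 ≤ d → IsZeroForcingSet d H B → IsZeroForcingSet d H′ B′ →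
  IsZeroForcingSet d (H □ H′) (B ⊠ B′)
⊠-isZeroForcingSet {d} {H} {H′} {B} {B′} 3≤d zf zf′
  with C₁ , steps₁ , rows-blue ← fibres-lift 3≤d (fibreˡ {H} {H′}) (filter (_∈? B′) (allFin (n H′))) zf
         (λ y∈members x∈B → ∈⊠⁺ x∈B (proj₂ (∈-filter⁻ (_∈? B′) {xs = allFin (n H′)} y∈members)))
  with C₂ , steps₂ , all-blue ← fibres-lift 3≤d (fibreʳ {H} {H′}) (allFin (n H)) zf′
         (λ {x} _ y∈B′ → rows-blue (∈-filter⁺ (_∈? B′) (∈-allFin _) y∈B′) x)
  = subst (Star (Step d (H □ H′)) (B ⊠ B′)) (∀combine∈⇒≡⊤ {n H} {n H′} λ x → all-blue (∈-allFin x))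
          (steps₁ ◅◅ steps₂)

theorem3p21 : (d : ℕ) → 3 ≤ d → (H H' : Hypergraph) → Uniform d H → Uniform d H' →
    (k k' m : ℕ) → IsZ0 d H k → IsZ0 d H' k' → IsZ0 d (H □ H') m → m ≤ k * k'
theorem3p21 d 3≤d H H′ _ _ k k′ m ((B , zf , ∣B∣≡k) , _) ((B′ , zf′ , ∣B′∣≡k′) , _) (_ , minimal) =
  subst (m ≤_) (trans (∣⊠∣ B B′) (cong₂ _*_ ∣B∣≡k ∣B′∣≡k′))
        (minimal (B ⊠ B′) (⊠-isZeroForcingSet 3≤d zf zf′))
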